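{- For all $d,k\in\mathbb{N}$, there is a $k$-robust map from the wedge digraph $W^{kd}$ to the wedge digraph $W^d$.
   Context: $W^n$ is the digraph whose vertices are nonnegative integer $n$-tuples, with an edge $x\to y$ iff $y$ is obtained from $x$ by increasing one coordinate by $1$, rooted at the zero tuple. If $G,H$ are rooted digraphs with roots $g_0,h_0$, a $k$-robust map from $G$ to $H$ is a map $\phi:V(G)\to V(H)$ with $\phi(g_0)=h_0$ such that whenever $\phi(v)\to w$ is an edge of $H$, there are at least $k$ vertices $z$ of $G$ with $\phi(z)=w$ and $v\to z$ an edge of $G$. -}

module Defs where

open import Data.Nat using (ℕ; suc)
open import Data.Fin using (Fin)
open import Data.Vec using (Vec; replicate; _[_]%=_)
open import Data.Product using (Σ; ∃; _×_)
open import Function.Definitions using (Injective)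
open import Relation.Binary.PropositionalEquality using (_≡_)

W : ℕ → Set
W n = Vec ℕ n

root : (n : ℕ) → W n
root n = replicate n 0

_⟶_ : {n : ℕ} → W n → W n → Set
_⟶_ {n} x y = ∃ λ (i : Fin n) → y ≡ (x [ i ]%= suc)

-- "there are at least k vertices z with v → z and φ z = w":
-- k pairwise distinct such vertices, given by an injective family Fin k → W m.
AtLeast : {m : ℕ} → (k : ℕ) → (W m → Set) → Set
AtLeast {m} k P =
  Σ (Fin k → W m) λ zs → Injective _≡_ _≡_ zs × (∀ j → P (zs j))

Robust : (k m n : ℕ) → (W m → W n) → Set
Robust k m n φ =
  (φ (root m) ≡ root n) ×
  (∀ (v : W m) (w : W n) → φ v ⟶ w →
     AtLeast k (λ z → (v ⟶ z) × (φ z ≡ w)))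

-- Split a (k·d)-tuple into k consecutive blocks of length d and add the
-- blocks coordinatewise.  This sends the zero tuple to the zero tuple, and
-- raising coordinate i of the image can be achieved by raising coordinate i
-- of any one of the k blocks; these k lifts are pairwise distinct vertices.
module Submission where

open import Defs
open import Data.Nat using (ℕ; _*_; _+_; zero; suc)
open import Data.Nat.Properties using (+-identityˡ; +-suc; 1+n≢n)
open import Data.Fin using (Fin; zero; suc; _↑ˡ_; _↑ʳ_; combine)
open import Data.Fin.Properties using (combine-injectiveˡ; _≟_)
open import Data.Vec using (Vec; _∷_; replicate; zipWith; take; drop; lookup; _[_]%=_)
open import Data.Vec.Properties using (zipWith-identityˡ; lookup∘updateAt; lookup∘updateAt′)
open import Data.Product using (Σ; _×_; _,_)
open import Function.Definitions using (Injective)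
open import Relation.Nullary using (yes; no; contradiction)
open import Relation.Binary.PropositionalEquality
  using (_≡_; _≢_; refl; cong; cong₂; module ≡-Reasoning)

private
  variable
    A : Set
    m n : ℕ

take-replicate : ∀ m (a : A) → take m (replicate (m + n) a) ≡ replicate m a
take-replicate zero    a = refl
take-replicate (suc m) a = cong (a ∷_) (take-replicate m a)

drop-replicate : ∀ m (a : A) → drop m (replicate (m + n) a) ≡ replicate n a
drop-replicate zero    a = refl
drop-replicate (suc m) a = drop-replicate m a

module _ {f : A → A} where

  take-[]%=-↑ˡ : ∀ (xs : Vec A (m + n)) (i : Fin m) →
                 take m (xs [ i ↑ˡ n ]%= f) ≡ take m xs [ i ]%= f
  take-[]%=-↑ˡ (x ∷ xs) zero    = refl
  take-[]%=-↑ˡ (x ∷ xs) (suc i) = cong (x ∷_) (take-[]%=-↑ˡ xs i)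

  drop-[]%=-↑ˡ : ∀ (xs : Vec A (m + n)) (i : Fin m) →
                 drop m (xs [ i ↑ˡ n ]%= f) ≡ drop m xs
  drop-[]%=-↑ˡ (x ∷ xs) zero    = refl
  drop-[]%=-↑ˡ (x ∷ xs) (suc i) = drop-[]%=-↑ˡ xs i

  take-[]%=-↑ʳ : ∀ m (xs : Vec A (m + n)) (p : Fin n) →
                 take m (xs [ m ↑ʳ p ]%= f) ≡ take m xs
  take-[]%=-↑ʳ zero    xs       p = refl
  take-[]%=-↑ʳ (suc m) (x ∷ xs) p = cong (x ∷_) (take-[]%=-↑ʳ m xs p)

  drop-[]%=-↑ʳ : ∀ m (xs : Vec A (m + n)) (p : Fin n) →
                 drop m (xs [ m ↑ʳ p ]%= f) ≡ drop m xs [ p ]%= f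
  drop-[]%=-↑ʳ zero    xs       p = refl
  drop-[]%=-↑ʳ (suc m) (x ∷ xs) p = drop-[]%=-↑ʳ m xs p

  []%=-injectiveˡ : (∀ x → f x ≢ x) → (xs : Vec A n) (i j : Fin n) →
                    xs [ i ]%= f ≡ xs [ j ]%= f → i ≡ j
  []%=-injectiveˡ f-fixfree xs i j eq with i ≟ j
  ... | yes i≡j = i≡j
  ... | no  i≢j = contradiction fxᵢ≡xᵢ (f-fixfree (lookup xs i))
    where
    open ≡-Reasoning
    fxᵢ≡xᵢ : f (lookup xs i) ≡ lookup xs i
    fxᵢ≡xᵢ = begin
      f (lookup xs i)           ≡⟨ lookup∘updateAt i xs ⟨
      lookup (xs [ i ]%= f) i   ≡⟨ cong (λ ys → lookup ys i) eq ⟩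
      lookup (xs [ j ]%= f) i   ≡⟨ lookup∘updateAt′ i j i≢j xs ⟩
      lookup xs i               ∎

module _ {_∙_ : A → A → A} {g h : A → A} where

  zipWith-[]%=ˡ : (∀ x y → g x ∙ y ≡ h (x ∙ y)) → (xs ys : Vec A n) (i : Fin n) →
                  zipWith _∙_ (xs [ i ]%= g) ys ≡ zipWith _∙_ xs ys [ i ]%= h
  zipWith-[]%=ˡ comm (x ∷ xs) (y ∷ ys) zero    = cong (_∷ zipWith _∙_ xs ys) (comm x y)
  zipWith-[]%=ˡ comm (x ∷ xs) (y ∷ ys) (suc i) = cong ((x ∙ y) ∷_) (zipWith-[]%=ˡ comm xs ys i)

  zipWith-[]%=ʳ : (∀ x y → x ∙ g y ≡ h (x ∙ y)) → (xs ys : Vec A n) (i : Fin n) →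
                  zipWith _∙_ xs (ys [ i ]%= g) ≡ zipWith _∙_ xs ys [ i ]%= h
  zipWith-[]%=ʳ comm (x ∷ xs) (y ∷ ys) zero    = cong (_∷ zipWith _∙_ xs ys) (comm x y)
  zipWith-[]%=ʳ comm (x ∷ xs) (y ∷ ys) (suc i) = cong ((x ∙ y) ∷_) (zipWith-[]%=ʳ comm xs ys i)

Robust-fromLifts : ∀ k m n (φ : W m → W n) (lift : Fin k → Fin n → Fin m) →
                   φ (root m) ≡ root n →
                   (∀ i → Injective _≡_ _≡_ (λ j → lift j i)) →
                   (∀ v j i → φ (v [ lift j i ]%= suc) ≡ φ v [ i ]%= suc) →
                   Robust k m n φ
Robust-fromLifts k m n φ lift φ-root lift-injective φ-lift = φ-root , robust
  where
  robust : ∀ v w → φ v ⟶ w → AtLeast k (λ z → (v ⟶ z) × (φ z ≡ w))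
  robust v _ (i , refl) =
      (λ j → v [ lift j i ]%= suc)
    , (λ eq → lift-injective i ([]%=-injectiveˡ (λ _ → 1+n≢n) v _ _ eq))
    , (λ j → (lift j i , refl) , φ-lift v j i)

sumBlocks : ∀ k {d} → Vec ℕ (k * d) → Vec ℕ d
sumBlocks zero    {d} _  = replicate d 0
sumBlocks (suc k) {d} xs = zipWith _+_ (take d xs) (sumBlocks k (drop d xs))

sumBlocks-root : ∀ k d → sumBlocks k (root (k * d)) ≡ root d
sumBlocks-root zero    d = refl
sumBlocks-root (suc k) d = begin
  zipWith _+_ (take d (root (d + k * d))) (sumBlocks k (drop d (root (d + k * d))))
    ≡⟨ cong₂ (zipWith _+_) (take-replicate d 0) (cong (sumBlocks k) (drop-replicate d 0)) ⟩
  zipWith _+_ (root d) (sumBlocks k (root (k * d)))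
    ≡⟨ cong (zipWith _+_ (root d)) (sumBlocks-root k d) ⟩
  zipWith _+_ (root d) (root d)
    ≡⟨ zipWith-identityˡ +-identityˡ (root d) ⟩
  root d ∎
  where open ≡-Reasoning

-- combine j i is coordinate i of the j-th block.
sumBlocks-[]%=-combine : ∀ k {d} (xs : Vec ℕ (k * d)) (j : Fin k) (i : Fin d) →
                         sumBlocks k (xs [ combine j i ]%= suc) ≡ sumBlocks k xs [ i ]%= suc
sumBlocks-[]%=-combine (suc k) {d} xs zero i
  rewrite take-[]%=-↑ˡ {f = suc} xs i | drop-[]%=-↑ˡ {f = suc} xs i
  = zipWith-[]%=ˡ (λ _ _ → refl) (take d xs) _ i
sumBlocks-[]%=-combine (suc k) {d} xs (suc j) i
  rewrite take-[]%=-↑ʳ {f = suc} d xs (combine j i) | drop-[]%=-↑ʳ {f = suc} d xs (combine j i)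
        | sumBlocks-[]%=-combine k (drop d xs) j i
  = zipWith-[]%=ʳ +-suc (take d xs) _ i

lemma15 : (d k : ℕ) → Σ (W (k * d) → W d) λ φ → Robust k (k * d) d φ
lemma15 d k = sumBlocks k
            , Robust-fromLifts k (k * d) d (sumBlocks k) combine
                (sumBlocks-root k d)
                (λ i eq → combine-injectiveˡ _ i _ i eq)
                (sumBlocks-[]%=-combine k)
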